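{- Let $s$ be an odd positive integer. Then the number of $(s,s+2)$-core partitions into distinct parts equals $2^{s-1}$. Equivalently, for every integer $k\ge 0$, the number of $(2k+1,2k+3)$-core partitions into distinct parts equals $2^{2k}$.
   Context: A partition is a weakly decreasing finite sequence of positive integers (the empty partition is allowed); its size is the sum of its parts. In the Young diagram of a partition, the hook length of a box is the number of boxes in the same row to its right, in the same column below it, plus one. For a positive integer $t$, a partition is a $t$-core if no box has hook length divisible by $t$; an $(s,t)$-core partition is one that is simultaneously an $s$-core and a $t$-core. A partition into distinct parts is one whose parts are pairwise distinct. -}

module Defs where

open import Data.Nat using (ℕ; zero; suc; _+_; _*_; _∸_; _≤_; _<_; _<?_)
open import Data.Nat.Divisibility using (_∣_)
open import Data.List using (List; []; _∷_; length; filter; drop)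
open import Data.List.Relation.Unary.All using (All)
open import Data.List.Relation.Unary.Linked using (Linked)
open import Data.List.Relation.Unary.Unique.Propositional using (Unique)
open import Data.Product using (_×_)
open import Relation.Nullary using (¬_)

IsPartition : List ℕ → Set
IsPartition p = Linked (λ a b → b ≤ a) p × All (λ x → 0 < x) p

IsDistinctPartition : List ℕ → Set
IsDistinctPartition p = IsPartition p × Unique p

-- i-th part (0-indexed), 0 beyond the length.
part : List ℕ → ℕ → ℕ
part []       _       = 0
part (x ∷ _)  zero    = x
part (_ ∷ xs) (suc i) = part xs i

leg : List ℕ → ℕ → ℕ → ℕ
leg p i j = length (filter (λ x → j <? x) (drop (suc i) p))

arm : List ℕ → ℕ → ℕ → ℕ
arm p i j = part p i ∸ suc j

hook : List ℕ → ℕ → ℕ → ℕ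
hook p i j = arm p i j + leg p i j + 1

-- The boxes of the Young diagram are the (i , j) with i < length p, j < part p i.
-- t-core: no box has hook length divisible by t.
IsCore : ℕ → List ℕ → Set
IsCore t p = ∀ i j → i < length p → j < part p i → ¬ (t ∣ hook p i j)

IsDistinctCore : ℕ → ℕ → List ℕ → Set
IsDistinctCore s t p = IsDistinctPartition p × IsCore s p × IsCore t p

-- A partition into distinct parts is determined by its set β of first-column hook lengths, which has
-- no two consecutive elements, and it is a t-core exactly when β is closed under x ↦ x − t (for
-- x ≥ t).  For s = 2k + 1 put β on the s-abacus, runner r carrying the beads r, r + s, …,
-- r + (n_r − 1) s.  Closure under s is built in; closure under s + 2, positivity and the gap
-- condition become: n_0 = 0, n_{r+2} ≤ n_r + 1, no two adjacent runners are both occupied, and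
-- n_1 ≤ n_{s−1} + 2.  Reading such vectors two runners at a time, the number of completions of
-- each state is a binomial coefficient, and the total is Σ_{i>k} C(2k+1, i) = 4^k.

module Submission where

open import Defs
open import Data.Nat
open import Data.Nat.Properties
open import Data.Nat.Divisibility using (_∣_; divides; ∣-refl)
open import Data.Nat.DivMod using (_%_; _/_; m≡m%n+[m/n]*n; m%n<n; m<n⇒m%n≡m; [m+kn]%n≡m%n)
open import Data.Nat.ListAction using (sum)
open import Data.Nat.Combinatorics using (_C_; nCk+nC[k+1]≡[n+1]C[k+1]; nCn≡1; nCk≡nC[n∸k]; k>n⇒nCk≡0)
open import Data.Nat.Tactic.RingSolver using (solve-∀)
open import Data.List using (List; []; _∷_; _++_; length; map; filter; applyUpTo; downFrom)
open import Data.List.Properties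
  using (filter-accept; filter-reject; length-filter; length-applyUpTo; length-++; length-map; ∷-injectiveʳ)
open import Data.List.Relation.Unary.All as All using (All; []; _∷_)
open import Data.List.Relation.Unary.All.Properties using () renaming (map⁺ to All-map⁺)
open import Data.List.Relation.Unary.Any using (here; there)
open import Data.List.Relation.Unary.Linked using (Linked; []; [-]; _∷_)
open import Data.List.Relation.Unary.AllPairs as AllPairs using (AllPairs; []; _∷_)
open import Data.List.Relation.Unary.Unique.Propositional using (Unique)
import Data.List.Relation.Unary.Unique.Propositional.Properties as Unique
open import Data.List.Membership.Propositional using (_∈_; _∉_)
open import Data.List.Membership.DecPropositional _≟_ using (_∈?_)
open import Data.List.Membership.Propositional.Properties
  using (∈-filter⁺; ∈-filter⁻; ∈-downFrom⁺; ∈-++⁺ˡ; ∈-++⁺ʳ; ∈-++⁻; ∈-map⁺; ∈-map⁻)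
import Data.List.Relation.Unary.AllPairs.Properties as AllPairs
open import Data.Product using (Σ; ∃; _×_; _,_; proj₁; proj₂)
open import Data.Empty using (⊥; ⊥-elim)
open import Data.Sum using (_⊎_; inj₁; inj₂)
open import Data.Unit using (⊤; tt)
open import Relation.Nullary using (¬_; Dec; yes; no)
open import Relation.Binary.PropositionalEquality
open import Function.Bundles using (_⇔_; mk⇔)

≡+⇒∸≡ : ∀ a b {c} → a ≡ b + c → a ∸ b ≡ c
≡+⇒∸≡ _ b {c} refl = m+n∸m≡n b c

All<⇒∉ : ∀ {b z} zs → All (_< b) zs → b ≤ z → z ∉ zs
All<⇒∉ (w ∷ ws) (w<b ∷ _)  b≤z (here refl) = <⇒≱ w<b b≤z
All<⇒∉ (w ∷ ws) (_ ∷ w<bs) b≤z (there z∈ws) = All<⇒∉ ws w<bs b≤z z∈ws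

All-<-weaken : ∀ {a b} {zs : List ℕ} → a ≤ b → All (_< a) zs → All (_< b) zs
All-<-weaken a≤b = All.map (λ z<a → <-≤-trans z<a a≤b)

-- Strict partitions and their β-sets

IsStrict : List ℕ → Set
IsStrict []       = ⊤
IsStrict (x ∷ xs) = 0 < x × All (_< x) xs × IsStrict xs

Decreasing : List ℕ → Set
Decreasing = AllPairs _>_

Decreasing₂ : List ℕ → Set
Decreasing₂ = AllPairs (λ x y → suc y < x)

-- The first-column hook lengths of a partition.
β : List ℕ → List ℕ
β []       = []
β (x ∷ xs) = x + length xs ∷ β xs

β⁻¹ : List ℕ → List ℕ
β⁻¹ []       = []
β⁻¹ (h ∷ hs) = h ∸ length hs ∷ β⁻¹ hs

length-β : ∀ p → length (β p) ≡ length p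
length-β []       = refl
length-β (x ∷ p) = cong suc (length-β p)

length-β⁻¹ : ∀ H → length (β⁻¹ H) ≡ length H
length-β⁻¹ []       = refl
length-β⁻¹ (h ∷ H) = cong suc (length-β⁻¹ H)

strict⇒distinctPartition : ∀ p → IsStrict p → IsDistinctPartition p
strict⇒distinctPartition p sp = (linked p sp , positive p sp) , unique p sp
  where
  linked : ∀ p → IsStrict p → Linked (λ a b → b ≤ a) p
  linked []           _                         = []
  linked (x ∷ [])     _                         = [-]
  linked (x ∷ y ∷ ys) (_ , (y<x ∷ _) , sp-y∷ys) = <⇒≤ y<x ∷ linked (y ∷ ys) sp-y∷ys
  positive : ∀ p → IsStrict p → All (0 <_) p
  positive []       _               = []
  positive (x ∷ xs) (0<x , _ , sp) = 0<x ∷ positive xs sp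
  unique : ∀ p → IsStrict p → Unique p
  unique []       _              = []
  unique (x ∷ xs) (_ , xs<x , sp) = All.map (λ y<x x≡y → <-irrefl (sym x≡y) y<x) xs<x ∷ unique xs sp

distinctPartition⇒strict : ∀ p → IsDistinctPartition p → IsStrict p
distinctPartition⇒strict []           _ = tt
distinctPartition⇒strict (x ∷ [])     ((_ , (0<x ∷ _)) , _) = 0<x , [] , tt
distinctPartition⇒strict (x ∷ y ∷ ys) ((y≤x ∷ lnk , 0<x ∷ pos) , ((x≢y ∷ _) ∷ uq))
  with distinctPartition⇒strict (y ∷ ys) ((lnk , pos) , uq)
... | sp@(_ , ys<y , _) = 0<x , (y<x ∷ All.map (λ z<y → <-trans z<y y<x) ys<y) , sp
  where
  y<x : y < x
  y<x = ≤∧≢⇒< y≤x (λ y≡x → x≢y (sym y≡x))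

Decreasing₂⇒Decreasing : ∀ {H} → Decreasing₂ H → Decreasing H
Decreasing₂⇒Decreasing = AllPairs.map (λ sy<x → <-trans (n<1+n _) sy<x)

β-bounded : ∀ y ys → All (_< y) ys → IsStrict ys → All (_< y + length ys) (β ys)
β-bounded y []       _              _                 = []
β-bounded y (z ∷ zs) (z<y ∷ zs<y) (_ , zs<z , sp-zs) =
  head< ∷ All-<-weaken (<⇒≤ head<) (β-bounded z zs zs<z sp-zs)
  where
  head< : z + length zs < y + suc (length zs)
  head< = subst (z + length zs <_) (sym (+-suc y (length zs)))
            (<-≤-trans (+-monoˡ-< (length zs) z<y) (n≤1+n _))

β-decreasing₂ : ∀ p → IsStrict p → Decreasing₂ (β p)
β-decreasing₂ []           _ = []
β-decreasing₂ (x ∷ [])     _ = [] ∷ []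
β-decreasing₂ (x ∷ y ∷ ys) (_ , (y<x ∷ _) , sp-y∷ys) with β-decreasing₂ (y ∷ ys) sp-y∷ys
... | ys<y ∷ dys =
  (head< ∷ All.map (λ sz<y → <-trans sz<y (<-trans (n<1+n _) head<)) ys<y) ∷ ys<y ∷ dys
  where
  head< : suc (y + length ys) < x + suc (length ys)
  head< = subst (suc (y + length ys) <_) (sym (+-suc x (length ys))) (s≤s (+-monoˡ-< (length ys) y<x))

β-positive : ∀ p → IsStrict p → All (0 <_) (β p)
β-positive []       _               = []
β-positive (x ∷ xs) (0<x , _ , sp) = ≤-trans 0<x (m≤m+n x (length xs)) ∷ β-positive xs sp

β⁻¹-β : ∀ p → β⁻¹ (β p) ≡ p
β⁻¹-β []      = refl
β⁻¹-β (x ∷ p) =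
  cong₂ _∷_ (trans (cong (x + length p ∸_) (length-β p)) (m+n∸n≡m x (length p))) (β⁻¹-β p)

length<head : ∀ h H → Decreasing₂ (h ∷ H) → All (0 <_) (h ∷ H) → length H < h
length<head h []        _                     (0<h ∷ _) = 0<h
length<head h (h' ∷ H') ((sh'<h ∷ _) ∷ dH') (_ ∷ pos) =
  <-trans (s≤s (length<head h' H' dH' pos)) sh'<h

β-β⁻¹ : ∀ H → Decreasing₂ H → All (0 <_) H → β (β⁻¹ H) ≡ H
β-β⁻¹ []      _          _   = refl
β-β⁻¹ (h ∷ H) d@(_ ∷ dH) pos@(_ ∷ posH) =
  cong₂ _∷_ (trans (cong (h ∸ length H +_) (length-β⁻¹ H)) (m∸n+n≡m (<⇒≤ (length<head h H d pos))))
            (β-β⁻¹ H dH posH)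

β⁻¹-bounded : ∀ h H → Decreasing₂ (h ∷ H) → All (0 <_) (h ∷ H) → All (_< h ∸ length H) (β⁻¹ H)
β⁻¹-bounded h []        _                    _           = []
β⁻¹-bounded h (h' ∷ H') ((sh'<h ∷ _) ∷ dH') (_ ∷ posH') =
  head< ∷ All-<-weaken (<⇒≤ head<) (β⁻¹-bounded h' H' dH' posH')
  where
  head< : h' ∸ length H' < h ∸ suc (length H')
  head< = ∸-monoˡ-< sh'<h (s≤s (<⇒≤ (length<head h' H' dH' posH')))

β⁻¹-strict : ∀ H → Decreasing₂ H → All (0 <_) H → IsStrict (β⁻¹ H)
β⁻¹-strict []      _          _ = tt
β⁻¹-strict (h ∷ H) d@(_ ∷ dH) pos@(_ ∷ posH) =
  m<n⇒0<n∸m (length<head h H d pos) , β⁻¹-bounded h H d pos , β⁻¹-strict H dH posH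

countAbove : ℕ → List ℕ → ℕ
countAbove j xs = length (filter (j <?_) xs)

-- rowHook x xs j is hook (x ∷ xs) 0 j, unfolded.
rowHook : ℕ → List ℕ → ℕ → ℕ
rowHook x xs j = x ∸ suc j + countAbove j xs + 1

countAbove-accept : ∀ {j y} ys → j < y → countAbove j (y ∷ ys) ≡ suc (countAbove j ys)
countAbove-accept ys j<y = cong length (filter-accept (_ <?_) j<y)

countAbove-reject : ∀ {j y} ys → y ≤ j → countAbove j (y ∷ ys) ≡ countAbove j ys
countAbove-reject ys y≤j = cong length (filter-reject (_ <?_) (λ j<y → <⇒≱ j<y y≤j))

countAbove-none : ∀ {j y} ys → All (_< y) ys → y ≤ j → countAbove j ys ≡ 0
countAbove-none []       _              _   = refl
countAbove-none (z ∷ zs) (z<y ∷ zs<y) y≤j =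
  trans (countAbove-reject zs (≤-trans (<⇒≤ z<y) y≤j)) (countAbove-none zs zs<y y≤j)

rowHook-positive : ∀ x xs j → 0 < rowHook x xs j
rowHook-positive x xs j = m≤n+m 1 (x ∸ suc j + countAbove j xs)

rowHook-≤ : ∀ x xs j → j < x → rowHook x xs j ≤ x + length xs
rowHook-≤ x xs j j<x = begin
  x ∸ suc j + countAbove j xs + 1 ≤⟨ +-monoˡ-≤ 1 (+-monoʳ-≤ (x ∸ suc j) (length-filter (j <?_) xs)) ⟩
  x ∸ suc j + length xs + 1       ≡⟨ +-comm (x ∸ suc j + length xs) 1 ⟩
  suc (x ∸ suc j) + length xs     ≡⟨ cong (_+ length xs) (+-∸-assoc 1 j<x) ⟨
  x ∸ j + length xs               ≤⟨ +-monoˡ-≤ (length xs) (m∸n≤m x j) ⟩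
  x + length xs                   ∎
  where open ≤-Reasoning

rowHook-beyond : ∀ x xs j → countAbove j xs ≡ 0 → j < x → rowHook x xs j ≡ x ∸ j
rowHook-beyond x xs j none j<x = begin
  x ∸ suc j + countAbove j xs + 1 ≡⟨ cong (λ c → x ∸ suc j + c + 1) none ⟩
  x ∸ suc j + 0 + 1               ≡⟨ cong (_+ 1) (+-identityʳ (x ∸ suc j)) ⟩
  x ∸ suc j + 1                   ≡⟨ +-comm (x ∸ suc j) 1 ⟩
  suc (x ∸ suc j)                 ≡⟨ +-∸-assoc 1 j<x ⟨
  x ∸ j                           ∎
  where open ≡-Reasoning

rowHook-below : ∀ x y ys j → j < y → y ≤ x →
                rowHook x (y ∷ ys) j ≡ rowHook y ys j + suc (x ∸ y)
rowHook-below x y ys j j<y y≤x = begin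
  x ∸ suc j + countAbove j (y ∷ ys) + 1 ≡⟨ cong₂ (λ a c → a + c + 1) x∸sj (countAbove-accept ys j<y) ⟩
  y ∸ suc j + D + suc c + 1             ≡⟨ lemma (y ∸ suc j) D c ⟩
  y ∸ suc j + c + 1 + suc D             ∎
  where
  open ≡-Reasoning
  D = x ∸ y
  c = countAbove j ys
  x∸sj : x ∸ suc j ≡ y ∸ suc j + D
  x∸sj = trans (cong (_∸ suc j) (sym (m+[n∸m]≡n y≤x))) (+-∸-comm D j<y)
  lemma : ∀ a d c → a + d + suc c + 1 ≡ a + c + 1 + suc d
  lemma = solve-∀

∸-beyond : ∀ x j L → j ≤ x → x + suc L ∸ (x ∸ j) ≡ j + suc L
∸-beyond x j L j≤x = begin
  x + suc L ∸ (x ∸ j)           ≡⟨ cong (λ a → a + suc L ∸ (x ∸ j)) (m∸n+n≡m j≤x) ⟨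
  x ∸ j + j + suc L ∸ (x ∸ j)   ≡⟨ cong (_∸ (x ∸ j)) (+-assoc (x ∸ j) j (suc L)) ⟩
  x ∸ j + (j + suc L) ∸ (x ∸ j) ≡⟨ m+n∸m≡n (x ∸ j) (j + suc L) ⟩
  j + suc L                     ∎
  where open ≡-Reasoning

∸-below : ∀ y D L w → y + D + suc L ∸ (w + suc D) ≡ y + L ∸ w
∸-below y D L w = begin
  y + D + suc L ∸ (w + suc D)   ≡⟨ cong₂ _∸_ (lemma y D L) (+-comm w (suc D)) ⟩
  suc D + (y + L) ∸ (suc D + w) ≡⟨ [m+n]∸[m+o]≡n∸o (suc D) (y + L) w ⟩
  y + L ∸ w                     ∎
  where
  open ≡-Reasoning
  lemma : ∀ y D L → y + D + suc L ≡ suc D + (y + L)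
  lemma = solve-∀

rowHook⇒gap : ∀ x xs → IsStrict (x ∷ xs) → ∀ j → j < x → x + length xs ∸ rowHook x xs j ∉ β xs
rowHook⇒gap x []       _ j j<x ()
rowHook⇒gap x (y ∷ ys) (_ , (y<x ∷ _) , sp@(_ , ys<y , sp-ys)) j j<x with j <? y
... | yes j<y = gap
  where
  L = length ys
  w = rowHook y ys j
  h∸v≡ : x + suc L ∸ rowHook x (y ∷ ys) j ≡ y + L ∸ w
  h∸v≡ = trans (cong₂ (λ a v → a + suc L ∸ v) (sym (m+[n∸m]≡n (<⇒≤ y<x)))
                                               (rowHook-below x y ys j j<y (<⇒≤ y<x)))
               (∸-below y (x ∸ y) L w)
  gap : x + suc L ∸ rowHook x (y ∷ ys) j ∉ β (y ∷ ys)
  gap (here eq)    = <-irrefl (trans (sym h∸v≡) eq)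
                       (∸-monoʳ-< (rowHook-positive y ys j) (rowHook-≤ y ys j j<y))
  gap (there mem) = rowHook⇒gap y ys sp j j<y (subst (_∈ β ys) h∸v≡ mem)
... | no j≮y =
  All<⇒∉ (y + L ∷ β ys) (≤-refl ∷ All-<-weaken (n≤1+n _) (β-bounded y ys ys<y sp-ys)) y+L<h∸v
  where
  L = length ys
  y≤j = ≮⇒≥ j≮y
  beyond : rowHook x (y ∷ ys) j ≡ x ∸ j
  beyond = rowHook-beyond x (y ∷ ys) j
             (trans (countAbove-reject ys y≤j) (countAbove-none ys ys<y y≤j)) j<x
  y+L<h∸v : suc (y + L) ≤ x + suc L ∸ rowHook x (y ∷ ys) j
  y+L<h∸v = subst (suc (y + L) ≤_) (sym (trans (cong (x + suc L ∸_) beyond) (∸-beyond x j L (<⇒≤ j<x))))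
              (subst (_≤ j + suc L) (+-suc y L) (+-monoˡ-≤ (suc L) y≤j))

gap⇒rowHook : ∀ x xs → IsStrict (x ∷ xs) → ∀ v → 0 < v → v ≤ x + length xs →
              x + length xs ∸ v ∉ β xs → ∃ λ j → j < x × rowHook x xs j ≡ v
gap⇒rowHook x [] _ v 0<v v≤h _ =
  x ∸ v , j<x , trans (rowHook-beyond x [] (x ∸ v) refl j<x) (m∸[m∸n]≡n v≤x)
  where
  v≤x = subst (v ≤_) (+-identityʳ x) v≤h
  j<x = ∸-monoʳ-< 0<v v≤x
gap⇒rowHook x (y ∷ ys) (_ , (y<x ∷ _) , sp@(_ , ys<y , _)) v 0<v v≤h gap with v ≤? x ∸ y
... | yes v≤D = x ∸ v , j<x , trans (rowHook-beyond x (y ∷ ys) (x ∸ v) none j<x) (m∸[m∸n]≡n v≤x)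
  where
  v≤x = ≤-trans v≤D (m∸n≤m x y)
  j<x = ∸-monoʳ-< 0<v v≤x
  y≤j : y ≤ x ∸ v
  y≤j = m+n≤o⇒m≤o∸n y (subst (y + v ≤_) (m+[n∸m]≡n (<⇒≤ y<x)) (+-monoʳ-≤ y v≤D))
  none = trans (countAbove-reject ys y≤j) (countAbove-none ys ys<y y≤j)
... | no v≰D = j , <-trans j<y y<x , trans (rowHook-below x y ys j j<y (<⇒≤ y<x)) (trans (cong (_+ suc D) w≡) v≡)
  where
  L = length ys
  D = x ∸ y
  x≡ : x ≡ y + D
  x≡ = sym (m+[n∸m]≡n (<⇒≤ y<x))
  h∸≡ : ∀ w → x + suc L ∸ (w + suc D) ≡ y + L ∸ w
  h∸≡ w = trans (cong (λ a → a + suc L ∸ (w + suc D)) x≡) (∸-below y D L w)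
  sD≤v = ≰⇒> v≰D
  w = v ∸ suc D
  v≡ : w + suc D ≡ v
  v≡ = m∸n+n≡m sD≤v
  sD<v : suc D < v
  sD<v = ≤∧≢⇒< sD≤v λ sD≡v → gap (here (trans (cong (x + suc L ∸_) (sym sD≡v)) (h∸≡ 0)))
  w≤y+L : w ≤ y + L
  w≤y+L = +-cancelʳ-≤ (suc D) w (y + L)
            (subst₂ _≤_ (sym v≡) (trans (cong (_+ suc L) x≡) (lemma y D L)) v≤h)
    where
    lemma : ∀ y D L → y + D + suc L ≡ y + L + suc D
    lemma = solve-∀
  ih = gap⇒rowHook y ys sp w (m<n⇒0<n∸m sD<v) w≤y+L
         (λ mem → gap (there (subst (_∈ β ys) (sym (trans (cong (x + suc L ∸_) (sym v≡)) (h∸≡ w))) mem)))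
  j = proj₁ ih
  j<y = proj₁ (proj₂ ih)
  w≡ = proj₂ (proj₂ ih)

-- Cores as β-sets closed under subtraction

Closed : ℕ → List ℕ → Set
Closed t H = ∀ x → x ∈ H → t ≤ x → x ∸ t ∈ H

closed-tail : ∀ {t h H} → All (_< h) H → Closed t (h ∷ H) → Closed t H
closed-tail {t} H<h cl x x∈H t≤x with cl x (there x∈H) t≤x
... | here x∸t≡h = ⊥-elim (<-irrefl x∸t≡h (≤-<-trans (m∸n≤m x t) (All.lookup H<h x∈H)))
... | there mem  = mem

closed-iterate : ∀ {t h H} → Closed t (h ∷ H) → ∀ m → m * t ≤ h → h ∸ m * t ∈ h ∷ H
closed-iterate             cl zero    _    = here refl
closed-iterate {t} {h} {H} cl (suc m) t+mt≤h =
  subst (_∈ h ∷ H) (trans (∸-+-assoc h (m * t) t) (cong (h ∸_) (+-comm (m * t) t)))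
        (cl (h ∸ m * t) (closed-iterate {t} {h} {H} cl m (≤-trans (m≤n+m (m * t) t) t+mt≤h))
            (m+n≤o⇒m≤o∸n t t+mt≤h))

core⇒closed : ∀ t p → 0 < t → IsStrict p → IsCore t p → Closed t (β p)
core⇒closed t (x ∷ xs) 0<t sp core y (here refl) t≤y with (x + length xs ∸ t) ∈? β xs
... | yes mem = there mem
... | no gap with gap⇒rowHook x xs sp t 0<t t≤y gap
...   | j , j<x , hook≡t = ⊥-elim (core 0 j (s≤s z≤n) j<x (subst (t ∣_) (sym hook≡t) ∣-refl))
core⇒closed t (x ∷ xs) 0<t (_ , _ , sp) core y (there mem) t≤y =
  there (core⇒closed t xs 0<t sp (λ i j i< j< → core (suc i) j (s≤s i<) j<) y mem t≤y)

closed⇒core : ∀ t p → IsStrict p → Closed t (β p) → IsCore t p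
closed⇒core t (x ∷ xs) sp cl zero j _ j<x (divides m v≡mt)
  with closed-iterate cl m (subst (_≤ x + length xs) v≡mt (rowHook-≤ x xs j j<x))
... | here eq   = <-irrefl (trans (cong (x + length xs ∸_) v≡mt) eq)
                    (∸-monoʳ-< (rowHook-positive x xs j) (rowHook-≤ x xs j j<x))
... | there mem = rowHook⇒gap x xs sp j j<x (subst (_∈ β xs) (cong (x + length xs ∸_) (sym v≡mt)) mem)
closed⇒core t (x ∷ xs) sp@(_ , _ , sp-xs) cl (suc i) j (s≤s i<) j<x =
  closed⇒core t xs sp-xs (closed-tail xs<h cl) i j i< j<x
  where xs<h = AllPairs.head (Decreasing₂⇒Decreasing (β-decreasing₂ (x ∷ xs) sp))

-- The s-abacus

part≤sum : ∀ n r → part n r ≤ sum n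
part≤sum []      r       = z≤n
part≤sum (x ∷ n) zero    = m≤m+n x (sum n)
part≤sum (x ∷ n) (suc r) = ≤-trans (part≤sum n r) (m≤n+m (sum n) x)

∈⇒≤sum : ∀ {x} H → x ∈ H → x ≤ sum H
∈⇒≤sum (y ∷ H) (here refl) = m≤m+n y (sum H)
∈⇒≤sum (y ∷ H) (there mem) = ≤-trans (∈⇒≤sum H mem) (m≤n+m (sum H) y)

part-applyUpTo : ∀ f n r → r < n → part (applyUpTo f n) r ≡ f r
part-applyUpTo f (suc n) zero    _         = refl
part-applyUpTo f (suc n) (suc r) (s≤s r<n) = part-applyUpTo (λ i → f (suc i)) n r r<n

⊆-tail : ∀ {c X Y} → All (_< c) X → (∀ {x} → x ∈ c ∷ X → x ∈ c ∷ Y) → ∀ {x} → x ∈ X → x ∈ Y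
⊆-tail X<c X⊆Y x∈X with X⊆Y (there x∈X)
... | here refl = ⊥-elim (<-irrefl refl (All.lookup X<c x∈X))
... | there x∈Y = x∈Y

decreasing-unique : ∀ A B → Decreasing A → Decreasing B →
                    (∀ {x} → x ∈ A → x ∈ B) → (∀ {x} → x ∈ B → x ∈ A) → A ≡ B
decreasing-unique []      []      _ _ _ _ = refl
decreasing-unique []      (b ∷ B) _ _ _ B⊆A with B⊆A (here refl)
... | ()
decreasing-unique (a ∷ A) []      _ _ A⊆B _ with A⊆B (here refl)
... | ()
decreasing-unique (a ∷ A) (b ∷ B) (A<a ∷ dA) (B<b ∷ dB) A⊆B B⊆A with A⊆B (here refl) | B⊆A (here refl)
... | here refl | _         = cong (a ∷_) (decreasing-unique A B dA dB (⊆-tail A<a A⊆B) (⊆-tail B<b B⊆A))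
... | there a∈B | here refl = cong (b ∷_) (decreasing-unique A B dA dB (⊆-tail A<a A⊆B) (⊆-tail B<b B⊆A))
... | there a∈B | there b∈A = ⊥-elim (<-asym (All.lookup B<b a∈B) (All.lookup A<a b∈A))

part-ext : ∀ n n' → length n ≡ length n' → (∀ {r} → r < length n → part n r ≡ part n' r) → n ≡ n'
part-ext []      []       _   _    = refl
part-ext (x ∷ n) (x' ∷ n') len same =
  cong₂ _∷_ (same (s≤s z≤n)) (part-ext n n' (suc-injective len) (λ r< → same (s≤s r<)))

part-beyond : ∀ n {r} → length n ≤ r → part n r ≡ 0
part-beyond []      _         = refl
part-beyond (x ∷ n) (s≤s le) = part-beyond n le

-- An abacus n has part n r beads on runner r < s, in positions r, r + s, …, r + (part n r ∸ 1) * s.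
module Abacus (s : ℕ) .{{_ : NonZero s}} where

  Bead : List ℕ → ℕ → Set
  Bead n x = ∃ λ r → ∃ λ q → r < s × x ≡ r + q * s × q < part n r

  runner-unique : ∀ {r r'} q q' → r < s → r' < s → r + q * s ≡ r' + q' * s → r ≡ r' × q ≡ q'
  runner-unique {r} {r'} q q' r<s r'<s eq =
    r≡r' , *-cancelʳ-≡ q q' s (+-cancelˡ-≡ r (q * s) (q' * s) (trans eq (cong (_+ q' * s) (sym r≡r'))))
    where
    open ≡-Reasoning
    r≡r' : r ≡ r'
    r≡r' = begin
      r                ≡⟨ m<n⇒m%n≡m r<s ⟨
      r % s            ≡⟨ [m+kn]%n≡m%n r q s ⟨
      (r + q * s) % s   ≡⟨ cong (_% s) eq ⟩
      (r' + q' * s) % s ≡⟨ [m+kn]%n≡m%n r' q' s ⟩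
      r' % s           ≡⟨ m<n⇒m%n≡m r'<s ⟩
      r'               ∎

  bead? : ∀ n x → Dec (Bead n x)
  bead? n x with x / s <? part n (x % s)
  ... | yes q< = yes (x % s , x / s , m%n<n x s , m≡m%n+[m/n]*n x s , q<)
  ... | no q≮ = no λ { (r , q , r<s , x≡ , q<) →
    let r≡ , q≡ = runner-unique q (x / s) r<s (m%n<n x s) (trans (sym x≡) (m≡m%n+[m/n]*n x s))
    in q≮ (subst₂ (λ q r → q < part n r) q≡ r≡ q<) }

  bead< : ∀ n {x} → Bead n x → x < sum n * s
  bead< n (r , q , r<s , refl , q<) =
    <-≤-trans (+-monoˡ-< (q * s) r<s) (*-monoˡ-≤ s (≤-trans q< (part≤sum n r)))

  beads : List ℕ → List ℕ
  beads n = filter (bead? n) (downFrom (sum n * s))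

  ∈beads⁻ : ∀ n {x} → x ∈ beads n → Bead n x
  ∈beads⁻ n mem = proj₂ (∈-filter⁻ (bead? n) {xs = downFrom (sum n * s)} mem)

  ∈beads⁺ : ∀ n {x} → Bead n x → x ∈ beads n
  ∈beads⁺ n b = ∈-filter⁺ (bead? n) (∈-downFrom⁺ (bead< n b)) b

  beads-decreasing : ∀ n → Decreasing (beads n)
  beads-decreasing n =
    AllPairs.filter⁺ (bead? n) (AllPairs.applyDownFrom⁺₁ (λ i → i) (sum n * s) (λ j<i _ → j<i))

  -- runnerLength H r m is one more than the largest q < m with r + q * s ∈ H (and 0 if there is none).
  runnerLength : List ℕ → ℕ → ℕ → ℕ
  runnerLength H r zero = 0
  runnerLength H r (suc m) with r + m * s ∈? H
  ... | yes _ = suc m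
  ... | no _  = runnerLength H r m

  abacusOf : List ℕ → List ℕ
  abacusOf H = applyUpTo (λ r → runnerLength H r (suc (sum H))) s

  length-abacusOf : ∀ H → length (abacusOf H) ≡ s
  length-abacusOf H = length-applyUpTo _ s

  runner-shift : ∀ r q → r + suc q * s ≡ s + (r + q * s)
  runner-shift r q = lemma r s q
    where
    lemma : ∀ r s q → r + (s + q * s) ≡ s + (r + q * s)
    lemma = solve-∀

  bead-∸ : ∀ {n x} → Bead n x → s ≤ x → Bead n (x ∸ s)
  bead-∸ (r , zero  , r<s , refl , _)  s≤x = ⊥-elim (<⇒≱ r<s (subst (s ≤_) (+-identityʳ r) s≤x))
  bead-∸ (r , suc q , r<s , refl , q<) _   =
    r , q , r<s , ≡+⇒∸≡ (r + suc q * s) s (runner-shift r q) , <-trans (n<1+n q) q<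

  module _ {H : List ℕ} (closed : Closed s H) where

    closed-runner : ∀ r q → r + suc q * s ∈ H → r + q * s ∈ H
    closed-runner r q mem =
      subst (_∈ H) (≡+⇒∸≡ (r + suc q * s) s (runner-shift r q))
            (closed (r + suc q * s) mem (≤-trans (m≤m+n s (q * s)) (m≤n+m _ r)))

    closed-runner* : ∀ r {q q'} → q' ≤ q → r + q * s ∈ H → r + q' * s ∈ H
    closed-runner* r {zero}  z≤n  mem = mem
    closed-runner* r {suc q} {q'} q'≤ mem with q' ≟ suc q
    ... | yes refl = mem
    ... | no q'≢   = closed-runner* r (≤-pred (≤∧≢⇒< q'≤ q'≢)) (closed-runner r q mem)

    runnerLength-sound : ∀ r m {q} → q < runnerLength H r m → r + q * s ∈ H
    runnerLength-sound r (suc m) q< with r + m * s ∈? H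
    ... | yes mem = closed-runner* r (≤-pred q<) mem
    ... | no _    = runnerLength-sound r m q<

    runnerLength-complete : ∀ r m {q} → q < m → r + q * s ∈ H → q < runnerLength H r m
    runnerLength-complete r (suc m) {q} q<sm mem with r + m * s ∈? H
    ... | yes _ = q<sm
    ... | no ∉H = runnerLength-complete r m (≤∧≢⇒< (≤-pred q<sm) λ { refl → ∉H mem }) mem

    part-abacusOf : ∀ {r} → r < s → part (abacusOf H) r ≡ runnerLength H r (suc (sum H))
    part-abacusOf {r} = part-applyUpTo _ s r

    ∈⇒runner : ∀ {r q} → r < s → r + q * s ∈ H → q < part (abacusOf H) r
    ∈⇒runner {r} {q} r<s mem = subst (q <_) (sym (part-abacusOf r<s)) (runnerLength-complete r _ q<bound mem)
      where
      q<bound : q < suc (sum H)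
      q<bound = s≤s (≤-trans (≤-trans (m≤m*n q s) (m≤n+m (q * s) r)) (∈⇒≤sum H mem))

    runner⇒∈ : ∀ {r q} → r < s → q < part (abacusOf H) r → r + q * s ∈ H
    runner⇒∈ {r} {q} r<s q< = runnerLength-sound r _ (subst (q <_) (part-abacusOf r<s) q<)

    ∈⇒bead : ∀ {x} → x ∈ H → Bead (abacusOf H) x
    ∈⇒bead {x} mem = x % s , x / s , m%n<n x s , x≡ , ∈⇒runner (m%n<n x s) (subst (_∈ H) x≡ mem)
      where x≡ = m≡m%n+[m/n]*n x s

    bead⇒∈ : ∀ {x} → Bead (abacusOf H) x → x ∈ H
    bead⇒∈ (r , q , r<s , refl , q<) = runner⇒∈ r<s q<

  runner-mono : ∀ {n n' r} → (∀ {x} → Bead n x → Bead n' x) → r < s → part n r ≤ part n' r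
  runner-mono {n} {n'} {r} n⊆n' r<s = ≮⇒≥ excess
    where
    excess : ¬ part n' r < part n r
    excess p'<p with n⊆n' (r , part n' r , r<s , refl , p'<p)
    ... | r' , q' , r'<s , eq , q'< with runner-unique (part n' r) q' r<s r'<s eq
    ...   | refl , refl = <-irrefl refl q'<

  bead-ext : ∀ n n' → length n ≡ s → length n' ≡ s →
             (∀ {x} → Bead n x → Bead n' x) → (∀ {x} → Bead n' x → Bead n x) → n ≡ n'
  bead-ext n n' len len' n⊆n' n'⊆n = part-ext n n' (trans len (sym len')) λ r< →
    let r<s = subst (_ <_) len r< in ≤-antisym (runner-mono {n} {n'} n⊆n' r<s) (runner-mono {n'} {n} n'⊆n r<s)

double : ℕ → ℕ
double zero    = 0
double (suc m) = suc (suc (double m))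

double≡2* : ∀ k → double k ≡ 2 * k
double≡2* zero    = refl
double≡2* (suc k) = trans (cong (λ m → suc (suc m)) (double≡2* k)) (sym (*-suc 2 k))

AdmissibleAt : List ℕ → ℕ → Set
AdmissibleAt l r = part l (suc (suc r)) ≤ suc (part l r) × (part l (suc r) ≡ 0 ⊎ part l (suc (suc r)) ≡ 0)

Admissible : List ℕ → Set
Admissible (u ∷ v ∷ w ∷ l) = w ≤ suc u × (v ≡ 0 ⊎ w ≡ 0) × Admissible (v ∷ w ∷ l)
Admissible _               = ⊤

admissible-at : ∀ l r → Admissible l → suc (suc r) < length l → AdmissibleAt l r
admissible-at (u ∷ v ∷ w ∷ l) zero    (w≤ , sparse , _) _         = w≤ , sparse
admissible-at (u ∷ v ∷ w ∷ l) (suc r) (_ , _ , adm)     (s≤s r<) = admissible-at (v ∷ w ∷ l) r adm r<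
admissible-at (u ∷ [])        _       _ (s≤s ())
admissible-at (u ∷ v ∷ [])    _       _ (s≤s (s≤s ()))

admissible-from : ∀ l → (∀ r → suc (suc r) < length l → AdmissibleAt l r) → Admissible l
admissible-from []              _  = tt
admissible-from (u ∷ [])        _  = tt
admissible-from (u ∷ v ∷ [])    _  = tt
admissible-from (u ∷ v ∷ w ∷ l) at =
  let w≤ , sparse = at 0 (s≤s (s≤s (s≤s z≤n)))
  in w≤ , sparse , admissible-from (v ∷ w ∷ l) (λ r r< → at (suc r) (s≤s r<))

-- For s = 2k + 1: runner 0 is empty since 0 is not a hook length, and the last inequality is closure
-- under s + 2 across the wrap-around from runner 1 to runner s − 1.
ValidAbacus : ℕ → List ℕ → Set
ValidAbacus k n =
  (∃ λ r → n ≡ 0 ∷ r × length r ≡ double k) × Admissible n × part n 1 ≤ 2 + part n (double k)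

module OddAbacus (k : ℕ) where

  s : ℕ
  s = suc (double k)

  open Abacus s public

  length-valid : ∀ {n} → ValidAbacus k n → length n ≡ s
  length-valid ((_ , refl , len) , _) = cong suc len

  bead-positive : ∀ {n x} → ValidAbacus k n → Bead n x → 0 < x
  bead-positive ((_ , refl , _) , _) (zero  , _ , _ , _    , ())
  bead-positive _                     (suc r , q , _ , refl , _) = s≤s z≤n

  no-consecutive-beads : ∀ {n x} → ValidAbacus k n → Bead n x → Bead n (suc x) → ⊥
  no-consecutive-beads valid@((rest , refl , _) , adm , _) (r , q , r<s , refl , q<) (r' , q' , r'<s , eq , q'<)
    with suc r <? s
  ... | yes sr<s with runner-unique q q' sr<s r'<s eq
  ...   | refl , refl with r
  ...     | zero    = n≮0 q<
  ...     | suc r₀ with admissible-at (0 ∷ rest) r₀ adm (subst (suc (suc r₀) <_) (sym (length-valid valid)) sr<s)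
  ...       | _ , inj₁ empty = n≮0 (subst (q <_) empty q<)
  ...       | _ , inj₂ empty = n≮0 (subst (q <_) empty q'<)
  no-consecutive-beads ((_ , refl , _) , _) (r , q , r<s , refl , q<) (r' , q' , r'<s , eq , q'<)
      | no sr≮s with runner-unique q' (suc q) r'<s (s≤s z≤n) (trans (sym eq) (cong (_+ q * s) r+1≡s))
    where r+1≡s = ≤-antisym r<s (≮⇒≥ sr≮s)
  ... | refl , _ = n≮0 q'<

  bead-∸₂ : ∀ {n x} → ValidAbacus k n → Bead n x → s + 2 ≤ x → Bead n (x ∸ (s + 2))
  bead-∸₂ ((_ , refl , _) , _) (zero , _ , _ , _ , ()) _
  bead-∸₂ _ (1 , 0 , _ , refl , _) le = ⊥-elim (1+n≰n (≤-trans (m≤n+m 2 s) le))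
  bead-∸₂ _ (1 , 1 , _ , refl , _) le =
    ⊥-elim (1+n≰n (+-cancelˡ-≤ s 2 1 (subst (s + 2 ≤_) (lemma s) le)))
    where
    lemma : ∀ s → 1 + (s + 0) ≡ s + 1
    lemma = solve-∀
  bead-∸₂ (_ , _ , wrap) (1 , suc (suc q) , _ , refl , q<) _ =
    double k , q , n<1+n (double k) , ≡+⇒∸≡ _ (s + 2) (lemma (double k) q) ,
    ≤-pred (≤-pred (≤-trans q< wrap))
    where
    lemma : ∀ d q → 1 + (suc d + (suc d + q * suc d)) ≡ (suc d + 2) + (d + q * suc d)
    lemma = solve-∀
  bead-∸₂ _ (suc (suc r) , zero , r<s , refl , _) le =
    ⊥-elim (<⇒≱ r<s (≤-trans (m≤m+n s 2) (subst (s + 2 ≤_) (+-identityʳ _) le)))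
  bead-∸₂ valid@((rest , refl , _) , adm , _) (suc (suc r) , suc q , r<s , refl , q<) _ =
    r , q , <-trans (n<1+n r) (<-trans (n<1+n (suc r)) r<s) , ≡+⇒∸≡ _ (s + 2) (lemma r s q) ,
    ≤-pred (<-≤-trans q< (proj₁ (admissible-at (0 ∷ rest) r adm r+2<len)))
    where
    r+2<len = subst (suc (suc r) <_) (sym (length-valid valid)) r<s
    lemma : ∀ r s q → suc (suc r) + (s + q * s) ≡ (s + 2) + (r + q * s)
    lemma = solve-∀

  module _ {H : List ℕ} (positive : All (0 <_) H) (no-consecutive : ∀ {x} → x ∈ H → suc x ∈ H → ⊥)
           (closed : Closed s H) (closed₂ : Closed (s + 2) H) where

    private
      n = abacusOf H

      ∈-∸₂ : ∀ {a b} → a ≡ (s + 2) + b → a ∈ H → b ∈ H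
      ∈-∸₂ {a} {b} a≡ mem =
        subst (_∈ H) (≡+⇒∸≡ a (s + 2) a≡) (closed₂ a mem (subst (s + 2 ≤_) (sym a≡) (m≤m+n (s + 2) b)))

    runner0-empty : part n 0 ≡ 0
    runner0-empty =
      n≤0⇒n≡0 (≮⇒≥ λ 0< → <-irrefl refl (All.lookup positive (runner⇒∈ closed (s≤s z≤n) 0<)))

    abacusOf-admissibleAt : ∀ r → suc (suc r) < length n → AdmissibleAt n r
    abacusOf-admissibleAt r r+2<len = step , sparse
      where
      r+2<s : suc (suc r) < s
      r+2<s = subst (suc (suc r) <_) (length-abacusOf H) r+2<len
      r+1<s = <-trans (n<1+n (suc r)) r+2<s
      r<s   = <-trans (n<1+n r) r+1<s
      step : part n (suc (suc r)) ≤ suc (part n r)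
      step with part n (suc (suc r)) ≤? suc (part n r)
      ... | yes le = le
      ... | no  gt =
        let c = part n r
        in ⊥-elim (<-irrefl refl
             (∈⇒runner closed r<s (∈-∸₂ (lemma r s c) (runner⇒∈ closed {q = suc c} r+2<s (≰⇒> gt)))))
        where
        lemma : ∀ r s c → suc (suc r) + suc c * s ≡ (s + 2) + (r + c * s)
        lemma = solve-∀
      sparse : part n (suc r) ≡ 0 ⊎ part n (suc (suc r)) ≡ 0
      sparse with part n (suc r) ≟ 0 | part n (suc (suc r)) ≟ 0
      ... | yes e | _     = inj₁ e
      ... | no _  | yes e = inj₂ e
      ... | no e₁ | no e₂ = ⊥-elim (no-consecutive (occupied r+1<s e₁) (occupied r+2<s e₂))
        where
        occupied : ∀ {r} → r < s → part n r ≢ 0 → r ∈ H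
        occupied {r} r<s nonempty = subst (_∈ H) (+-identityʳ r) (runner⇒∈ closed r<s (n≢0⇒n>0 nonempty))

    abacusOf-wrap : part n 1 ≤ 2 + part n (double k)
    abacusOf-wrap with 1 <? s
    ... | no 1≮s =
      subst (_≤ 2 + part n (double k)) (sym (part-beyond n (subst (_≤ 1) (sym (length-abacusOf H)) (≮⇒≥ 1≮s)))) z≤n
    ... | yes 1<s with part n 1 ≤? 2 + part n (double k)
    ...   | yes le = le
    ...   | no  gt =
      let c = part n (double k)
      in ⊥-elim (<-irrefl refl (∈⇒runner closed (n<1+n (double k))
           (∈-∸₂ (lemma (double k) c) (runner⇒∈ closed {q = suc (suc c)} 1<s (≰⇒> gt)))))
      where
      lemma : ∀ d c → 1 + (suc d + (suc d + c * suc d)) ≡ (suc d + 2) + (d + c * suc d)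
      lemma = solve-∀

    abacusOf-valid : ValidAbacus k n
    abacusOf-valid =
      (runners , cong (_∷ runners) runner0-empty , length-applyUpTo _ (double k)) ,
      admissible-from n abacusOf-admissibleAt , abacusOf-wrap
      where runners = applyUpTo (λ r → runnerLength H (suc r) (suc (sum H))) (double k)

concatUpTo : {A : Set} → (ℕ → List A) → ℕ → List A
concatUpTo F zero    = []
concatUpTo F (suc a) = concatUpTo F a ++ F a

sumUpTo : (ℕ → ℕ) → ℕ → ℕ
sumUpTo f zero    = 0
sumUpTo f (suc a) = sumUpTo f a + f a

length-concatUpTo : ∀ {A : Set} (F : ℕ → List A) a → length (concatUpTo F a) ≡ sumUpTo (λ i → length (F i)) a
length-concatUpTo F zero    = refl
length-concatUpTo F (suc a) =
  trans (length-++ (concatUpTo F a)) (cong (_+ length (F a)) (length-concatUpTo F a))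

∈-concatUpTo⁻ : ∀ {A : Set} {F : ℕ → List A} {v} a → v ∈ concatUpTo F a → ∃ λ i → i < a × v ∈ F i
∈-concatUpTo⁻ {F = F} (suc a) mem with ∈-++⁻ (concatUpTo F a) mem
... | inj₁ mem′ = let i , i<a , v∈Fi = ∈-concatUpTo⁻ a mem′ in i , m<n⇒m<1+n i<a , v∈Fi
... | inj₂ v∈Fa = a , n<1+n a , v∈Fa

∈-concatUpTo⁺ : ∀ {A : Set} {F : ℕ → List A} {v i} a → i < a → v ∈ F i → v ∈ concatUpTo F a
∈-concatUpTo⁺ {F = F} {i = i} (suc a) i<sa mem with i ≟ a
... | yes refl = ∈-++⁺ʳ (concatUpTo F a) mem
... | no  i≢a  = ∈-++⁺ˡ (∈-concatUpTo⁺ a (≤∧≢⇒< (≤-pred i<sa) i≢a) mem)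

unique-concatUpTo : ∀ {A : Set} {F : ℕ → List A} (tag : A → ℕ) → (∀ {i v} → v ∈ F i → tag v ≡ i) →
                    (∀ i → Unique (F i)) → ∀ a → Unique (concatUpTo F a)
unique-concatUpTo tag tagged unique zero    = []
unique-concatUpTo tag tagged unique (suc a) =
  Unique.++⁺ (unique-concatUpTo tag tagged unique a) (unique a) λ (v∈ , v∈Fa) →
    let i , i<a , v∈Fi = ∈-concatUpTo⁻ a v∈ in <-irrefl (trans (sym (tagged v∈Fi)) (tagged v∈Fa)) i<a

sumUpTo-cong : ∀ {f g} a → (∀ i → f i ≡ g i) → sumUpTo f a ≡ sumUpTo g a
sumUpTo-cong zero    _   = refl
sumUpTo-cong (suc a) f≗g = cong₂ _+_ (sumUpTo-cong a f≗g) (f≗g a)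

sumUpTo-+ : ∀ f g a → sumUpTo (λ i → f i + g i) a ≡ sumUpTo f a + sumUpTo g a
sumUpTo-+ f g zero    = refl
sumUpTo-+ f g (suc a) = trans (cong (_+ (f a + g a)) (sumUpTo-+ f g a)) (lemma (sumUpTo f a) (sumUpTo g a) (f a) (g a))
  where
  lemma : ∀ a b c d → a + b + (c + d) ≡ a + c + (b + d)
  lemma = solve-∀

sumUpTo-suc : ∀ f a → sumUpTo f (suc a) ≡ f 0 + sumUpTo (λ i → f (suc i)) a
sumUpTo-suc f zero    = +-comm 0 (f 0)
sumUpTo-suc f (suc a) =
  trans (cong (_+ f (suc a)) (sumUpTo-suc f a)) (+-assoc (f 0) (sumUpTo (λ i → f (suc i)) a) (f (suc a)))

pascal : ∀ n k → suc n C suc k ≡ n C k + n C suc k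
pascal n k = sym (nCk+nC[k+1]≡[n+1]C[k+1] n k)

-- trimmedC n c k is (n ∸ c) C k, except that it vanishes when c > n.
trimmedC : ℕ → ℕ → ℕ → ℕ
trimmedC n       zero    k = n C k
trimmedC zero    (suc c) k = 0
trimmedC (suc n) (suc c) k = trimmedC n c k

trimmedC-cong : ∀ {n n' k k'} c → n ≡ n' → k ≡ k' → trimmedC n c k ≡ trimmedC n' c k'
trimmedC-cong c refl refl = refl

trimmedC-pascal : ∀ n c k → trimmedC (suc n) c (suc k) ≡ trimmedC n c k + trimmedC n c (suc k)
trimmedC-pascal n       zero          k = pascal n k
trimmedC-pascal zero    (suc zero)    k = refl
trimmedC-pascal zero    (suc (suc c)) k = refl
trimmedC-pascal (suc n) (suc c)       k = trimmedC-pascal n c k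

trimmedC-offset : ∀ c r k → trimmedC (c + r) c k ≡ r C k
trimmedC-offset zero    r k = refl
trimmedC-offset (suc c) r k = trimmedC-offset c r k

trimmedC-vanishes : ∀ n c {k} → n < k → trimmedC n c k ≡ 0
trimmedC-vanishes n       zero    n<k = k>n⇒nCk≡0 n<k
trimmedC-vanishes zero    (suc c) _   = refl
trimmedC-vanishes (suc n) (suc c) n<k = trimmedC-vanishes n c (<-trans (n<1+n n) n<k)

trimmedC-diagonal : ∀ x c → trimmedC 0 c 0 ≡ trimmedC (suc x) c (suc x)
trimmedC-diagonal x zero    = sym (nCn≡1 (suc x))
trimmedC-diagonal x (suc c) = sym (trimmedC-vanishes x c (n<1+n x))

rangeC : ℕ → ℕ → ℕ → ℕ
rangeC n lo = sumUpTo (λ i → n C (lo + i))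

rangeC-pascal : ∀ n lo len → rangeC (suc n) (suc lo) len ≡ rangeC n lo len + rangeC n (suc lo) len
rangeC-pascal n lo len = trans (sumUpTo-cong len (λ i → pascal n (lo + i))) (sumUpTo-+ _ _ len)

rangeC-first : ∀ n lo len → rangeC n lo (suc len) ≡ n C lo + rangeC n (suc lo) len
rangeC-first n lo len =
  trans (sumUpTo-suc (λ i → n C (lo + i)) len)
        (cong₂ _+_ (cong (n C_) (+-identityʳ lo)) (sumUpTo-cong len (λ i → cong (n C_) (+-suc lo i))))

rangeC-beyond : ∀ n lo len e → n < lo + len → rangeC n lo (len + e) ≡ rangeC n lo len
rangeC-beyond n lo len zero    _  = cong (rangeC n lo) (+-identityʳ len)
rangeC-beyond n lo len (suc e) n< = begin
  rangeC n lo (len + suc e)                    ≡⟨ cong (rangeC n lo) (+-suc len e) ⟩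
  rangeC n lo (len + e) + n C (lo + (len + e)) ≡⟨ cong₂ _+_ (rangeC-beyond n lo len e n<) (k>n⇒nCk≡0 n<lo+len+e) ⟩
  rangeC n lo len + 0                          ≡⟨ +-identityʳ _ ⟩
  rangeC n lo len                              ∎
  where
  open ≡-Reasoning
  n<lo+len+e = <-≤-trans n< (+-monoʳ-≤ lo (m≤m+n len e))

upperHalf : ℕ → ℕ
upperHalf k = rangeC (suc (double k)) (suc k) (suc k)

upperHalf-suc : ∀ k → upperHalf (suc k) ≡ 4 * upperHalf k
upperHalf-suc k = begin
  upperHalf (suc k)
    ≡⟨ rangeC-pascal (suc n) (suc k) (suc (suc k)) ⟩
  rangeC (suc n) (suc k) (suc (suc k)) + rangeC (suc n) (suc (suc k)) (suc (suc k))
    ≡⟨ cong₂ _+_ (rangeC-pascal n k (suc (suc k))) (rangeC-pascal n (suc k) (suc (suc k))) ⟩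
  (rangeC n k (suc (suc k)) + S′) + (S′ + R′)
    ≡⟨ cong₂ (λ a b → (a + b) + (b + R′)) (rangeC-first n k (suc k)) S′≡S ⟩
  (n C k + S + S) + (S + R′)
    ≡⟨ cong₂ (λ a b → (a + S + S) + (S + b)) symmetric R′≡R ⟩
  (n C suc k + S + S) + (S + R)
    ≡⟨ lemma (n C suc k) R S (rangeC-first n (suc k) k) ⟩
  4 * S ∎
  where
  open ≡-Reasoning
  n  = suc (double k)
  S  = upperHalf k
  S′ = rangeC n (suc k) (suc (suc k))
  R  = rangeC n (suc (suc k)) k
  R′ = rangeC n (suc (suc k)) (suc (suc k))
  n≡ : n ≡ suc (k + k)
  n≡ = cong suc (trans (double≡2* k) (cong (k +_) (+-identityʳ k)))
  S′≡S : S′ ≡ S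
  S′≡S = trans (cong (rangeC n (suc k)) (+-comm 1 (suc k)))
               (rangeC-beyond n (suc k) (suc k) 1
                  (subst (_< suc k + suc k) (sym n≡) (≤-reflexive (sym (cong suc (+-suc k k))))))
  R′≡R : R′ ≡ R
  R′≡R = trans (cong (rangeC n (suc (suc k))) (+-comm 2 k))
               (rangeC-beyond n (suc (suc k)) k 2 (subst (_< suc (suc k) + k) (sym n≡) ≤-refl))
  symmetric : n C k ≡ n C suc k
  symmetric = trans (nCk≡nC[n∸k] (subst (k ≤_) (sym n≡) (≤-trans (m≤m+n k k) (n≤1+n _))))
                    (cong (n C_) (trans (cong (_∸ k) n≡)
                                        (trans (+-∸-assoc 1 (m≤m+n k k)) (cong suc (m+n∸m≡n k k)))))
  lemma : ∀ b R S → S ≡ b + R → (b + S + S) + (S + R) ≡ 4 * S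
  lemma b R S refl = lemma′ b R
    where
    lemma′ : ∀ b R → (b + (b + R) + (b + R)) + ((b + R) + R) ≡ 4 * (b + R)
    lemma′ = solve-∀

upperHalf≡4^ : ∀ k → upperHalf k ≡ 4 ^ k
upperHalf≡4^ zero    = refl
upperHalf≡4^ (suc k) = trans (upperHalf-suc k) (cong (4 *_) (upperHalf≡4^ k))

-- Enumerating admissible sequences

lastOf : ℕ → List ℕ → ℕ
lastOf y []      = y
lastOf y (z ∷ l) = lastOf z l

Extension : ℕ → ℕ → ℕ → ℕ → List ℕ → Set
Extension m x y c l = length l ≡ double m × Admissible (x ∷ y ∷ l) × c ≤ lastOf y l

emptyExtension : ℕ → ℕ → List (List ℕ)
emptyExtension zero    y       = [] ∷ []
emptyExtension (suc c) zero    = []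
emptyExtension (suc c) (suc y) = emptyExtension c y

prefixed : ℕ → ℕ → List (List ℕ) → List (List ℕ)
prefixed a b = map (λ l → a ∷ b ∷ l)

afterZero : (ℕ → List (List ℕ)) → ℕ → List (List ℕ) → List (List ℕ)
afterZero F a L = concatUpTo (λ i → prefixed i 0 (F i)) a ++ prefixed 0 1 L

prefixed-unique : ∀ a b {L} → Unique L → Unique (prefixed a b L)
prefixed-unique a b = Unique.map⁺ (λ eq → ∷-injectiveʳ (∷-injectiveʳ eq))

∈-prefixed : ∀ {a b L v} → v ∈ prefixed a b L → part v 0 ≡ a × part v 1 ≡ b
∈-prefixed {a} {b} mem with ∈-map⁻ (λ l → a ∷ b ∷ l) mem
... | _ , _ , refl = refl , refl

length-prefixed-concatUpTo : ∀ (F : ℕ → List (List ℕ)) (a b : ℕ → ℕ) n →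
  length (concatUpTo (λ i → prefixed (a i) (b i) (F i)) n) ≡ sumUpTo (λ i → length (F i)) n
length-prefixed-concatUpTo F a b n =
  trans (length-concatUpTo _ n) (sumUpTo-cong n (λ i → length-map (λ l → a i ∷ b i ∷ l) (F i)))

length-afterZero : ∀ F a L → length (afterZero F a L) ≡ sumUpTo (λ i → length (F i)) a + length L
length-afterZero F a L =
  trans (length-++ (concatUpTo _ a))
        (cong₂ _+_ (length-prefixed-concatUpTo F (λ i → i) (λ _ → 0) a) (length-map (λ l → 0 ∷ 1 ∷ l) L))

afterZero-unique : ∀ {F L} a → (∀ i → Unique (F i)) → Unique L → Unique (afterZero F a L)
afterZero-unique {F} a unique-F unique-L =
  Unique.++⁺ (unique-concatUpTo (λ v → part v 0) (λ mem → proj₁ (∈-prefixed mem))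
                                (λ i → prefixed-unique i 0 (unique-F i)) a)
             (prefixed-unique 0 1 unique-L)
             λ (v∈ , v∈′) → let _ , _ , v∈F = ∈-concatUpTo⁻ a v∈
                            in 1+n≢0 (trans (sym (proj₂ (∈-prefixed v∈′))) (proj₂ (∈-prefixed v∈F)))

∈-afterZero⁻ : ∀ F a L {v} → v ∈ afterZero F a L →
               (∃ λ i → ∃ λ l → i < a × l ∈ F i × v ≡ i ∷ 0 ∷ l) ⊎ (∃ λ l → l ∈ L × v ≡ 0 ∷ 1 ∷ l)
∈-afterZero⁻ F a L mem with ∈-++⁻ (concatUpTo (λ i → prefixed i 0 (F i)) a) mem
... | inj₁ mem₁ =
  let i , i<a , mem₂ = ∈-concatUpTo⁻ a mem₁
      l , l∈ , v≡ = ∈-map⁻ (λ l → i ∷ 0 ∷ l) mem₂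
  in inj₁ (i , l , i<a , l∈ , v≡)
... | inj₂ mem₁ = inj₂ (∈-map⁻ (λ l → 0 ∷ 1 ∷ l) mem₁)

∈-afterZero⁺ˡ : ∀ F {a} L {i l} → i < a → l ∈ F i → i ∷ 0 ∷ l ∈ afterZero F a L
∈-afterZero⁺ˡ F L {i} i<a l∈ = ∈-++⁺ˡ (∈-concatUpTo⁺ _ i<a (∈-map⁺ (λ l → i ∷ 0 ∷ l) l∈))

∈-afterZero⁺ʳ : ∀ F a {L l} → l ∈ L → 0 ∷ 1 ∷ l ∈ afterZero F a L
∈-afterZero⁺ʳ F a l∈ =
  ∈-++⁺ʳ (concatUpTo (λ i → prefixed i 0 (F i)) a) (∈-map⁺ (λ l → 0 ∷ 1 ∷ l) l∈)

-- After (x , 0) the next pair is (a , 0) with a ≤ x + 1, or (0 , 1);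
-- after (_ , y) with y > 0 it is (0 , b) with b ≤ y + 2.
extensions : ℕ → ℕ → ℕ → ℕ → List (List ℕ)
extensions zero    x y       c = emptyExtension c y
extensions (suc m) x zero    c = afterZero (λ a → extensions m a 0 c) (suc (suc x)) (extensions m 0 1 c)
extensions (suc m) x (suc y) c = concatUpTo (λ b → prefixed 0 b (extensions m 0 b c)) (suc (suc (suc y)))

extCount : ℕ → ℕ → ℕ → ℕ → ℕ
extCount m x zero    c = trimmedC (suc (double m + x)) c (suc (m + x))
extCount m x (suc y) c = trimmedC (double m + suc y) c m

extCount-after0-step : ∀ m x c → extCount (suc m) (suc x) 0 c ≡ extCount (suc m) x 0 c + extCount m (suc (suc x)) 0 c
extCount-after0-step m x c = begin
  trimmedC (suc (suc (suc d) + suc x)) c (suc (suc m + suc x))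
    ≡⟨ trimmedC-cong c (cong suc (+-suc (suc (suc d)) x)) (cong suc (+-suc (suc m) x)) ⟩
  trimmedC (suc N) c (suc K)
    ≡⟨ trimmedC-pascal N c K ⟩
  trimmedC N c K + trimmedC N c (suc K)
    ≡⟨ cong (trimmedC N c K +_) (trimmedC-cong c (lemma d x) (lemma m x)) ⟩
  extCount (suc m) x 0 c + extCount m (suc (suc x)) 0 c ∎
  where
  open ≡-Reasoning
  d = double m
  N = suc (suc (suc d) + x)
  K = suc (suc m + x)
  lemma : ∀ a x → suc (suc (suc a) + x) ≡ suc (a + suc (suc x))
  lemma = solve-∀

extCount-after0-base : ∀ m c → extCount (suc m) 0 0 c ≡ (extCount m 0 0 c + extCount m 1 0 c) + extCount m 0 1 c
extCount-after0-base m c = begin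
  trimmedC (suc (suc (suc d) + 0)) c (suc (suc m + 0))
    ≡⟨ trimmedC-cong c (cong (λ z → suc (suc (suc z))) (+-identityʳ d))
                       (cong (λ z → suc (suc z)) (+-identityʳ m)) ⟩
  trimmedC (suc (suc N)) c (suc (suc m))
    ≡⟨ trimmedC-pascal (suc N) c (suc m) ⟩
  trimmedC (suc N) c (suc m) + trimmedC (suc N) c (suc (suc m))
    ≡⟨ cong (_+ trimmedC (suc N) c (suc (suc m))) (trimmedC-pascal N c m) ⟩
  (trimmedC N c m + trimmedC N c (suc m)) + trimmedC (suc N) c (suc (suc m))
    ≡⟨ lemma (trimmedC N c m) (trimmedC N c (suc m)) (trimmedC (suc N) c (suc (suc m))) ⟩
  (trimmedC N c (suc m) + trimmedC (suc N) c (suc (suc m))) + trimmedC N c m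
    ≡⟨ cong₂ (λ a b → (a + b) + trimmedC N c m)
         (trimmedC-cong c (cong suc (sym (+-identityʳ d))) (cong suc (sym (+-identityʳ m))))
         (trimmedC-cong c (cong suc (+-comm 1 d)) (cong suc (+-comm 1 m))) ⟩
  (extCount m 0 0 c + extCount m 1 0 c) + trimmedC N c m
    ≡⟨ cong ((extCount m 0 0 c + extCount m 1 0 c) +_) (trimmedC-cong c (+-comm 1 d) refl) ⟩
  (extCount m 0 0 c + extCount m 1 0 c) + extCount m 0 1 c ∎
  where
  open ≡-Reasoning
  d = double m
  N = suc d
  lemma : ∀ a b e → (a + b) + e ≡ (b + e) + a
  lemma = solve-∀

extCount-after+-step : ∀ m x y c →
  extCount (suc m) x (suc (suc y)) c ≡ extCount (suc m) x (suc y) c + extCount m 0 (suc (suc (suc y))) c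
extCount-after+-step m x y c = begin
  trimmedC (suc (suc d) + suc (suc y)) c (suc m)
    ≡⟨ trimmedC-cong c (+-suc (suc (suc d)) (suc y)) refl ⟩
  trimmedC (suc N) c (suc m)
    ≡⟨ trimmedC-pascal N c m ⟩
  trimmedC N c m + trimmedC N c (suc m)
    ≡⟨ +-comm (trimmedC N c m) (trimmedC N c (suc m)) ⟩
  trimmedC N c (suc m) + trimmedC N c m
    ≡⟨ cong (trimmedC N c (suc m) +_) (trimmedC-cong c (lemma d y) refl) ⟩
  extCount (suc m) x (suc y) c + extCount m 0 (suc (suc (suc y))) c ∎
  where
  open ≡-Reasoning
  d = double m
  N = suc (suc d) + suc y
  lemma : ∀ a y → suc (suc a) + suc y ≡ a + suc (suc (suc y))
  lemma = solve-∀

extCount-after+-base : ∀ m x c → extCount (suc m) x 1 c ≡ (extCount m 0 0 c + extCount m 0 1 c) + extCount m 0 2 c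
extCount-after+-base m x c = begin
  trimmedC (suc (suc d) + 1) c (suc m)
    ≡⟨ trimmedC-cong c (cong suc (+-comm (suc d) 1)) refl ⟩
  trimmedC (suc (suc N)) c (suc m)
    ≡⟨ trimmedC-pascal (suc N) c m ⟩
  trimmedC (suc N) c m + trimmedC (suc N) c (suc m)
    ≡⟨ cong (trimmedC (suc N) c m +_) (trimmedC-pascal N c m) ⟩
  trimmedC (suc N) c m + (trimmedC N c m + trimmedC N c (suc m))
    ≡⟨ lemma (trimmedC (suc N) c m) (trimmedC N c m) (trimmedC N c (suc m)) ⟩
  (trimmedC N c (suc m) + trimmedC N c m) + trimmedC (suc N) c m
    ≡⟨ cong₂ (λ a b → (a + trimmedC N c m) + b)
         (trimmedC-cong c (cong suc (sym (+-identityʳ d))) (cong suc (sym (+-identityʳ m))))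
         (trimmedC-cong c (+-comm 2 d) refl) ⟩
  (extCount m 0 0 c + trimmedC N c m) + extCount m 0 2 c
    ≡⟨ cong (λ a → (extCount m 0 0 c + a) + extCount m 0 2 c) (trimmedC-cong c (+-comm 1 d) refl) ⟩
  (extCount m 0 0 c + extCount m 0 1 c) + extCount m 0 2 c ∎
  where
  open ≡-Reasoning
  d = double m
  N = suc d
  lemma : ∀ a b e → a + (b + e) ≡ (e + b) + a
  lemma = solve-∀

sumUpTo-after0 : ∀ m x c → sumUpTo (λ a → extCount m a 0 c) (suc (suc x)) + extCount m 0 1 c ≡ extCount (suc m) x 0 c
sumUpTo-after0 m zero    c = sym (extCount-after0-base m c)
sumUpTo-after0 m (suc x) c = begin
  sumUpTo f (suc (suc x)) + f (suc (suc x)) + e ≡⟨ lemma (sumUpTo f (suc (suc x))) (f (suc (suc x))) e ⟩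
  sumUpTo f (suc (suc x)) + e + f (suc (suc x)) ≡⟨ cong (_+ f (suc (suc x))) (sumUpTo-after0 m x c) ⟩
  extCount (suc m) x 0 c + f (suc (suc x))     ≡⟨ extCount-after0-step m x c ⟨
  extCount (suc m) (suc x) 0 c                 ∎
  where
  open ≡-Reasoning
  f = λ a → extCount m a 0 c
  e = extCount m 0 1 c
  lemma : ∀ a b e → a + b + e ≡ a + e + b
  lemma = solve-∀

sumUpTo-after+ : ∀ m x y c → sumUpTo (λ b → extCount m 0 b c) (suc (suc (suc y))) ≡ extCount (suc m) x (suc y) c
sumUpTo-after+ m x zero    c = sym (extCount-after+-base m x c)
sumUpTo-after+ m x (suc y) c =
  trans (cong (_+ extCount m 0 (suc (suc (suc y))) c) (sumUpTo-after+ m x y c)) (sym (extCount-after+-step m x y c))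

length-emptyExtension : ∀ c y → length (emptyExtension c y) ≡ trimmedC y c 0
length-emptyExtension zero    y       = refl
length-emptyExtension (suc c) zero    = refl
length-emptyExtension (suc c) (suc y) = length-emptyExtension c y

length-extensions : ∀ m x y c → length (extensions m x y c) ≡ extCount m x y c
length-extensions zero    x zero    c = trans (length-emptyExtension c 0) (trimmedC-diagonal x c)
length-extensions zero    x (suc y) c = length-emptyExtension c (suc y)
length-extensions (suc m) x zero    c = begin
  length (afterZero (λ a → extensions m a 0 c) (suc (suc x)) (extensions m 0 1 c))
    ≡⟨ length-afterZero (λ a → extensions m a 0 c) (suc (suc x)) (extensions m 0 1 c) ⟩
  sumUpTo (λ a → length (extensions m a 0 c)) (suc (suc x)) + length (extensions m 0 1 c)
    ≡⟨ cong₂ _+_ (sumUpTo-cong (suc (suc x)) (λ a → length-extensions m a 0 c)) (length-extensions m 0 1 c) ⟩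
  sumUpTo (λ a → extCount m a 0 c) (suc (suc x)) + extCount m 0 1 c
    ≡⟨ sumUpTo-after0 m x c ⟩
  extCount (suc m) x 0 c ∎
  where open ≡-Reasoning
length-extensions (suc m) x (suc y) c = begin
  length (concatUpTo _ (suc (suc (suc y))))
    ≡⟨ length-prefixed-concatUpTo (λ b → extensions m 0 b c) (λ _ → 0) (λ b → b) (suc (suc (suc y))) ⟩
  sumUpTo (λ b → length (extensions m 0 b c)) (suc (suc (suc y)))
    ≡⟨ sumUpTo-cong (suc (suc (suc y))) (λ b → length-extensions m 0 b c) ⟩
  sumUpTo (λ b → extCount m 0 b c) (suc (suc (suc y)))
    ≡⟨ sumUpTo-after+ m x y c ⟩
  extCount (suc m) x (suc y) c ∎
  where open ≡-Reasoning

emptyExtension-sound : ∀ c y {l} → l ∈ emptyExtension c y → l ≡ [] × c ≤ y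
emptyExtension-sound zero    y       (here refl) = refl , z≤n
emptyExtension-sound (suc c) (suc y) mem         = let l≡[] , c≤y = emptyExtension-sound c y mem in l≡[] , s≤s c≤y

emptyExtension-complete : ∀ c y → c ≤ y → [] ∈ emptyExtension c y
emptyExtension-complete zero    y       _         = here refl
emptyExtension-complete (suc c) (suc y) (s≤s c≤y) = emptyExtension-complete c y c≤y

extensions-sound : ∀ m x y c l → l ∈ extensions m x y c → Extension m x y c l
extensions-sound zero x y c l mem with emptyExtension-sound c y mem
... | refl , c≤y = refl , tt , c≤y
extensions-sound (suc m) x zero c l mem
  with ∈-afterZero⁻ (λ a → extensions m a 0 c) (suc (suc x)) (extensions m 0 1 c) mem
... | inj₁ (a , l′ , a<x+2 , l′∈ , refl) =
  let len , adm , c≤ = extensions-sound m a 0 c l′ l′∈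
  in cong (λ n → suc (suc n)) len , (≤-pred a<x+2 , inj₁ refl , z≤n , inj₂ refl , adm) , c≤
... | inj₂ (l′ , l′∈ , refl) =
  let len , adm , c≤ = extensions-sound m 0 1 c l′ l′∈
  in cong (λ n → suc (suc n)) len , (z≤n , inj₁ refl , s≤s z≤n , inj₁ refl , adm) , c≤
extensions-sound (suc m) x (suc y) c l mem with ∈-concatUpTo⁻ (suc (suc (suc y))) mem
... | b , b<y+3 , mem₁ with ∈-map⁻ (λ l → 0 ∷ b ∷ l) mem₁
...   | l′ , l′∈ , refl with extensions-sound m 0 b c l′ l′∈
...     | len , adm , c≤ = cong (λ n → suc (suc n)) len , (z≤n , inj₂ refl , ≤-pred b<y+3 , inj₁ refl , adm) , c≤

extensions-complete : ∀ m x y c l → Extension m x y c l → l ∈ extensions m x y c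
extensions-complete zero    x y       c []             (_ , _ , c≤y) = emptyExtension-complete c y c≤y
extensions-complete (suc m) x zero    c (a ∷ zero ∷ l) (len , (a≤ , _ , _ , _ , adm) , c≤) =
  ∈-afterZero⁺ˡ (λ a → extensions m a 0 c) (extensions m 0 1 c) (s≤s a≤)
    (extensions-complete m a 0 c l (suc-injective (suc-injective len) , adm , c≤))
extensions-complete (suc m) x zero    c (a ∷ suc b ∷ l) (len , (_ , _ , s≤s b≤0 , a≡0⊎ , adm) , c≤)
  with a≡0⊎ | b≤0
... | inj₁ refl | z≤n =
  ∈-afterZero⁺ʳ (λ a → extensions m a 0 c) (suc (suc x))
    (extensions-complete m 0 1 c l (suc-injective (suc-injective len) , adm , c≤))
extensions-complete (suc m) x (suc y) c (a ∷ b ∷ l)    (len , (_ , a≡0⊎ , b≤ , _ , adm) , c≤) with a≡0⊎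
... | inj₂ refl =
  ∈-concatUpTo⁺ (suc (suc (suc y))) (s≤s b≤)
    (∈-map⁺ (λ l → 0 ∷ b ∷ l) (extensions-complete m 0 b c l (suc-injective (suc-injective len) , adm , c≤)))

emptyExtension-unique : ∀ c y → Unique (emptyExtension c y)
emptyExtension-unique zero    y       = [] ∷ []
emptyExtension-unique (suc c) zero    = []
emptyExtension-unique (suc c) (suc y) = emptyExtension-unique c y

extensions-unique : ∀ m x y c → Unique (extensions m x y c)
extensions-unique zero    x y       c = emptyExtension-unique c y
extensions-unique (suc m) x zero    c =
  afterZero-unique (suc (suc x)) (λ a → extensions-unique m a 0 c) (extensions-unique m 0 1 c)
extensions-unique (suc m) x (suc y) c =
  unique-concatUpTo (λ v → part v 1) (λ mem → proj₂ (∈-prefixed mem))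
                    (λ b → prefixed-unique 0 b (extensions-unique m 0 b c)) (suc (suc (suc y)))

part-lastOf : ∀ y l {d} → length l ≡ d → part (y ∷ l) d ≡ lastOf y l
part-lastOf y []      refl = refl
part-lastOf y (z ∷ l) refl = part-lastOf z l refl

lastOf-bound : ∀ m u v l → length l ≡ double m → Admissible (u ∷ v ∷ l) → lastOf v l ≤ v + m
lastOf-bound zero    u v []          _   _                     = m≤m+n v 0
lastOf-bound (suc m) u v (x ∷ y ∷ l) len (_ , _ , y≤ , _ , adm) =
  ≤-trans (lastOf-bound m x y l (suc-injective (suc-injective len)) adm)
          (≤-trans (+-monoˡ-≤ m y≤) (≤-reflexive (sym (+-suc v m))))

-- For k = m + 1 a valid abacus is 0 ∷ a ∷ b ∷ l with either b = 0, where the wrap-around condition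
-- bounds the last runner from below by a ∸ 2, or (a , b) = (0 , 1).
validAbaci : ℕ → List (List ℕ)
validAbaci zero    = (0 ∷ []) ∷ []
validAbaci (suc m) = map (0 ∷_) (afterZero (λ a → extensions m a 0 (a ∸ 2)) (suc (suc (suc m))) (extensions m 0 1 0))

validAbaci-sound : ∀ k {n} → n ∈ validAbaci k → ValidAbacus k n
validAbaci-sound zero    (here refl) = ([] , refl , refl) , tt , z≤n
validAbaci-sound (suc m) mem with ∈-map⁻ (0 ∷_) mem
... | l , l∈ , refl with ∈-afterZero⁻ (λ a → extensions m a 0 (a ∸ 2)) (suc (suc (suc m))) (extensions m 0 1 0) l∈
...   | inj₁ (a , l′ , _ , l′∈ , refl) =
  let len , adm , a∸2≤ = extensions-sound m a 0 (a ∸ 2) l′ l′∈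
  in (_ , refl , cong (λ n → suc (suc n)) len) , (z≤n , inj₂ refl , adm) ,
     ≤-trans (m≤n+m∸n a 2) (+-monoʳ-≤ 2 (subst (a ∸ 2 ≤_) (sym (part-lastOf 0 l′ len)) a∸2≤))
...   | inj₂ (l′ , l′∈ , refl) =
  let len , adm , _ = extensions-sound m 0 1 0 l′ l′∈
  in (_ , refl , cong (λ n → suc (suc n)) len) , (s≤s z≤n , inj₁ refl , adm) , z≤n

validAbaci-complete : ∀ k {n} → ValidAbacus k n → n ∈ validAbaci k
validAbaci-complete zero    (([] , refl , refl) , _) = here refl
validAbaci-complete (suc m) ((a ∷ zero ∷ l , refl , len) , (_ , _ , adm) , wrap) =
  ∈-map⁺ (0 ∷_) (∈-afterZero⁺ˡ (λ a → extensions m a 0 (a ∸ 2)) (extensions m 0 1 0) a<m+3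
                  (extensions-complete m a 0 (a ∸ 2) l (len′ , adm , m≤n+o⇒m∸n≤o a 2 a≤)))
  where
  len′ = suc-injective (suc-injective len)
  a≤ : a ≤ 2 + lastOf 0 l
  a≤ = subst (λ z → a ≤ 2 + z) (part-lastOf 0 l len′) wrap
  a<m+3 : a < suc (suc (suc m))
  a<m+3 = s≤s (≤-trans a≤ (s≤s (s≤s (lastOf-bound m a 0 l len′ adm))))
validAbaci-complete (suc m) ((a ∷ suc b ∷ l , refl , len) , (s≤s b≤0 , a≡0⊎ , adm) , _) with a≡0⊎ | b≤0
... | inj₁ refl | z≤n =
  ∈-map⁺ (0 ∷_) (∈-afterZero⁺ʳ (λ a → extensions m a 0 (a ∸ 2)) (suc (suc (suc m)))
                  (extensions-complete m 0 1 0 l (suc-injective (suc-injective len) , adm , z≤n)))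

validAbaci-unique : ∀ k → Unique (validAbaci k)
validAbaci-unique zero    = [] ∷ []
validAbaci-unique (suc m) =
  Unique.map⁺ ∷-injectiveʳ
    (afterZero-unique (suc (suc (suc m))) (λ a → extensions-unique m a 0 (a ∸ 2)) (extensions-unique m 0 1 0))

extCount-wrap : ∀ m j → extCount m (suc (suc j)) 0 j ≡ suc (suc (suc (double m))) C (suc (suc (suc m)) + j)
extCount-wrap m j = trans (trimmedC-cong j (lemma₁ (double m) j) (lemma₂ m j)) (trimmedC-offset j _ _)
  where
  lemma₁ : ∀ d j → suc (d + suc (suc j)) ≡ j + suc (suc (suc d))
  lemma₁ = solve-∀
  lemma₂ : ∀ m j → suc (m + suc (suc j)) ≡ suc (suc (suc m)) + j
  lemma₂ = solve-∀

sumUpTo-wrap : ∀ m j → sumUpTo (λ a → extCount m a 0 (a ∸ 2)) (suc (suc j)) ≡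
               (extCount m 0 0 0 + extCount m 1 0 0) + rangeC (suc (suc (suc (double m)))) (suc (suc (suc m))) j
sumUpTo-wrap m zero    = sym (+-identityʳ _)
sumUpTo-wrap m (suc j) =
  trans (cong₂ _+_ (sumUpTo-wrap m j) (extCount-wrap m j)) (+-assoc (extCount m 0 0 0 + extCount m 1 0 0) _ _)

length-validAbaci : ∀ k → length (validAbaci k) ≡ 4 ^ k
length-validAbaci zero    = refl
length-validAbaci (suc m) = begin
  length (map (0 ∷_) (afterZero (λ a → extensions m a 0 (a ∸ 2)) (suc (suc (suc m))) (extensions m 0 1 0)))
    ≡⟨ length-map (0 ∷_) (afterZero _ (suc (suc (suc m))) _) ⟩
  length (afterZero (λ a → extensions m a 0 (a ∸ 2)) (suc (suc (suc m))) (extensions m 0 1 0))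
    ≡⟨ length-afterZero (λ a → extensions m a 0 (a ∸ 2)) (suc (suc (suc m))) (extensions m 0 1 0) ⟩
  sumUpTo (λ a → length (extensions m a 0 (a ∸ 2))) (suc (suc (suc m))) + length (extensions m 0 1 0)
    ≡⟨ cong₂ _+_ (sumUpTo-cong (suc (suc (suc m))) (λ a → length-extensions m a 0 (a ∸ 2)))
                 (length-extensions m 0 1 0) ⟩
  sumUpTo (λ a → extCount m a 0 (a ∸ 2)) (suc (suc (suc m))) + extCount m 0 1 0
    ≡⟨ cong (_+ extCount m 0 1 0) (sumUpTo-wrap m (suc m)) ⟩
  (extCount m 0 0 0 + extCount m 1 0 0) + R + extCount m 0 1 0
    ≡⟨ cong₂ (λ a b → (a + b) + R + extCount m 0 1 0) e₀₀ e₁₀ ⟩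
  (suc d C suc m + suc (suc d) C suc (suc m)) + R + extCount m 0 1 0
    ≡⟨ cong (λ a → (suc d C suc m + suc (suc d) C suc (suc m)) + R + a) e₀₁ ⟩
  (suc d C suc m + suc (suc d) C suc (suc m)) + R + suc d C m
    ≡⟨ lemma (suc d C suc m) (suc (suc d) C suc (suc m)) R (suc d C m) ⟩
  ((suc d C m + suc d C suc m) + suc (suc d) C suc (suc m)) + R
    ≡⟨ cong (λ a → (a + suc (suc d) C suc (suc m)) + R) (pascal (suc d) m) ⟨
  (suc (suc d) C suc m + suc (suc d) C suc (suc m)) + R
    ≡⟨ cong (_+ R) (pascal (suc (suc d)) (suc m)) ⟨
  suc (suc (suc d)) C suc (suc m) + R
    ≡⟨ rangeC-first (suc (suc (suc d))) (suc (suc m)) (suc m) ⟨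
  upperHalf (suc m)
    ≡⟨ upperHalf≡4^ (suc m) ⟩
  4 ^ suc m ∎
  where
  open ≡-Reasoning
  d = double m
  R = rangeC (suc (suc (suc d))) (suc (suc (suc m))) (suc m)
  e₀₀ : extCount m 0 0 0 ≡ suc d C suc m
  e₀₀ = cong₂ (λ a b → suc a C suc b) (+-identityʳ d) (+-identityʳ m)
  e₁₀ : extCount m 1 0 0 ≡ suc (suc d) C suc (suc m)
  e₁₀ = cong₂ (λ a b → suc a C suc b) (+-comm d 1) (+-comm m 1)
  e₀₁ : extCount m 0 1 0 ≡ suc d C m
  e₀₁ = cong (_C m) (+-comm d 1)
  lemma : ∀ a b r c → (a + b) + r + c ≡ ((c + a) + b) + r
  lemma = solve-∀

-- From valid abaci to cores

unique-map-on : ∀ {A B : Set} {P : A → Set} (f : A → B) → (∀ {x y} → P x → P y → f x ≡ f y → x ≡ y) →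
                ∀ {xs} → All P xs → Unique xs → Unique (map f xs)
unique-map-on f inj []         []           = []
unique-map-on f inj (px ∷ pxs) (x∉xs ∷ uxs) =
  All-map⁺ (All.zipWith (λ (x≢y , py) fx≡fy → x≢y (inj px py fx≡fy)) (x∉xs , pxs))
  ∷ unique-map-on f inj pxs uxs

decreasing⇒decreasing₂ : ∀ {H} → Decreasing H → (∀ {x} → x ∈ H → suc x ∈ H → ⊥) → Decreasing₂ H
decreasing⇒decreasing₂ []                       _    = []
decreasing⇒decreasing₂ {h ∷ H} (H<h ∷ dH) gap =
  All.tabulate (λ y∈H → ≤∧≢⇒< (All.lookup H<h y∈H)
                                (λ sy≡h → gap (there y∈H) (subst (_∈ h ∷ H) (sym sy≡h) (here refl))))
  ∷ decreasing⇒decreasing₂ dH (λ x∈H sx∈H → gap (there x∈H) (there sx∈H))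

decreasing₂⇒no-consecutive : ∀ {H x} → Decreasing₂ H → x ∈ H → suc x ∈ H → ⊥
decreasing₂⇒no-consecutive (_ ∷ _)    (here refl) (here sx≡x)  = 1+n≢n sx≡x
decreasing₂⇒no-consecutive (H<h ∷ _)  (here refl) (there sh∈H) =
  <-asym (All.lookup H<h sh∈H) (<-trans (n<1+n _) (n<1+n _))
decreasing₂⇒no-consecutive (H<h ∷ _)  (there x∈H) (here refl)  = <-irrefl refl (All.lookup H<h x∈H)
decreasing₂⇒no-consecutive (_ ∷ dH)   (there x∈H) (there sx∈H) = decreasing₂⇒no-consecutive dH x∈H sx∈H

module Correspondence (k : ℕ) where

  open OddAbacus k

  toPartition : List ℕ → List ℕ
  toPartition n = β⁻¹ (beads n)

  module _ {n : List ℕ} (valid : ValidAbacus k n) where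

    beads-positive : All (0 <_) (beads n)
    beads-positive = All.tabulate (λ mem → bead-positive valid (∈beads⁻ n mem))

    beads-decreasing₂ : Decreasing₂ (beads n)
    beads-decreasing₂ = decreasing⇒decreasing₂ (beads-decreasing n)
      (λ x∈ sx∈ → no-consecutive-beads valid (∈beads⁻ n x∈) (∈beads⁻ n sx∈))

    β-toPartition : β (toPartition n) ≡ beads n
    β-toPartition = β-β⁻¹ (beads n) beads-decreasing₂ beads-positive

    beads-closed : Closed s (beads n)
    beads-closed x x∈ s≤x = ∈beads⁺ n (bead-∸ {n} (∈beads⁻ n x∈) s≤x)

    beads-closed₂ : Closed (s + 2) (beads n)
    beads-closed₂ x x∈ s+2≤x = ∈beads⁺ n (bead-∸₂ valid (∈beads⁻ n x∈) s+2≤x)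

    toPartition-core : IsDistinctCore s (s + 2) (toPartition n)
    toPartition-core =
      strict⇒distinctPartition _ strict ,
      closed⇒core s _ strict (subst (Closed s) (sym β-toPartition) beads-closed) ,
      closed⇒core (s + 2) _ strict (subst (Closed (s + 2)) (sym β-toPartition) beads-closed₂)
      where strict = β⁻¹-strict (beads n) beads-decreasing₂ beads-positive

  toPartition-injective : ∀ {n n'} → ValidAbacus k n → ValidAbacus k n' → toPartition n ≡ toPartition n' → n ≡ n'
  toPartition-injective {n} {n'} valid valid' eq =
    bead-ext n n' (length-valid valid) (length-valid valid')
      (λ b → ∈beads⁻ n' (subst (_ ∈_) same (∈beads⁺ n b)))
      (λ b → ∈beads⁻ n (subst (_ ∈_) (sym same) (∈beads⁺ n' b)))
    where
    same : beads n ≡ beads n'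
    same = trans (sym (β-toPartition valid)) (trans (cong β eq) (β-toPartition valid'))

  core⇒toPartition : ∀ {p} → IsDistinctCore s (s + 2) p → ∃ λ n → ValidAbacus k n × toPartition n ≡ p
  core⇒toPartition {p} (distinct , core , core₂) =
    n , valid , trans (cong β⁻¹ beads≡H) (β⁻¹-β p)
    where
    strict = distinctPartition⇒strict p distinct
    H = β p
    n = abacusOf H
    decreasing₂ = β-decreasing₂ p strict
    closed = core⇒closed s p (s≤s z≤n) strict core
    valid = abacusOf-valid (β-positive p strict) (decreasing₂⇒no-consecutive decreasing₂)
                           closed (core⇒closed (s + 2) p (s≤s z≤n) strict core₂)
    beads≡H : beads n ≡ H
    beads≡H = decreasing-unique (beads n) H (beads-decreasing n) (Decreasing₂⇒Decreasing decreasing₂)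
                (λ mem → bead⇒∈ closed (∈beads⁻ n mem)) (λ mem → ∈beads⁺ n (∈⇒bead closed mem))

Enumerated : ℕ → Set
Enumerated s = Σ (List (List ℕ)) λ L →
  Unique L × (∀ p → (p ∈ L) ⇔ IsDistinctCore s (s + 2) p) × length L ≡ 2 ^ (s ∸ 1)

enumerated : ∀ k → Enumerated (suc (double k))
enumerated k = L , unique , (λ p → mk⇔ sound (complete p)) , count
  where
  open Correspondence k
  L = map toPartition (validAbaci k)

  unique : Unique L
  unique = unique-map-on toPartition toPartition-injective (All.tabulate (validAbaci-sound k)) (validAbaci-unique k)

  sound : ∀ {p} → p ∈ L → IsDistinctCore (suc (double k)) (suc (double k) + 2) p
  sound mem with ∈-map⁻ toPartition mem
  ... | n , n∈ , refl = toPartition-core (validAbaci-sound k n∈)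

  complete : ∀ p → IsDistinctCore (suc (double k)) (suc (double k) + 2) p → p ∈ L
  complete p core with core⇒toPartition core
  ... | n , valid , refl = ∈-map⁺ toPartition (validAbaci-complete k valid)

  count : length L ≡ 2 ^ double k
  count = trans (length-map toPartition (validAbaci k))
                (trans (length-validAbaci k) (trans (^-*-assoc 2 2 k) (cong (2 ^_) (sym (double≡2* k)))))

mainTheorem1 : (s : ℕ) → (∃ λ k → s ≡ suc (2 * k)) →
    Σ (List (List ℕ)) λ L →
      Unique L × (∀ p → (p ∈ L) ⇔ IsDistinctCore s (s + 2) p) × length L ≡ 2 ^ (s ∸ 1)
mainTheorem1 s (k , refl) = subst Enumerated (cong suc (double≡2* k)) (enumerated k)
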